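{- Let $n\ge3$. For nonnegative integers $m,u$, let $V(m,u)$ be the set of positions $x$ of Exco-Nim with parameter $n$ with $m(x)=m$ and $u(x)=u$. Then all $x\in V(m,u)$ have the same set $\mathcal{L}(x)=\{(m(x'),u(x')) : x\to x'\text{ is a legal move}\}$.
   Context: Exco-Nim with parameter $n$: positions are tuples $x=(x_0,x_1,\ldots,x_n)$ of nonnegative integers. A legal move $x\to x'$ is to a tuple $x'$ of nonnegative integers with $x'_j\le x_j$ for all $j$, $\sum_j x'_j<\sum_j x_j$, and $x'_i=x_i$ for at least one index $1\le i\le n$. For a position $x$: $m(x)=\min_{1\le i\le n}x_i$ and $u(x)=\sum_{i=0}^n x_i$. -}

module Defs where

open import Data.Nat using (ℕ; zero; suc; _+_; _≤_; _<_; _⊓_)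
open import Data.Fin using (Fin; zero; suc)
open import Data.Product using (Σ; _×_; ∃)
open import Relation.Binary.PropositionalEquality using (_≡_)

-- A position of Exco-Nim with parameter n: a tuple (x_0, x_1, ..., x_n),
-- represented as a function Fin (suc n) → ℕ (index 0 is x_0).
Position : ℕ → Set
Position n = Fin (suc n) → ℕ

sumF : ∀ {k} → (Fin k → ℕ) → ℕ
sumF {zero}  f = 0
sumF {suc k} f = f zero + sumF (λ i → f (suc i))

minF : ∀ {k} → (Fin (suc k) → ℕ) → ℕ
minF {zero}  f = f zero
minF {suc k} f = f zero ⊓ minF (λ i → f (suc i))

-- m(x) = min_{1 ≤ i ≤ n} x_i.  Only meaningful for n ≥ 1; the value 0 for
-- n = 0 is an irrelevant default (the theorem assumes n ≥ 3).
mOf : ∀ {n} → Position n → ℕ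
mOf {zero}  x = 0
mOf {suc n} x = minF (λ i → x (suc i))

uOf : ∀ {n} → Position n → ℕ
uOf x = sumF x

Move : ∀ {n} → Position n → Position n → Set
Move {n} x x' =
  (∀ j → x' j ≤ x j) × (uOf x' < uOf x) × (∃ λ (i : Fin n) → x' (suc i) ≡ x (suc i))

InL : ∀ {n} → Position n → ℕ → ℕ → Set
InL x a b = ∃ λ x' → Move x x' × (mOf x' ≡ a) × (uOf x' ≡ b)

InV : ∀ {n} → Position n → ℕ → ℕ → Set
InV x m u = (mOf x ≡ m) × (uOf x ≡ u)

module Submission where

-- The set 𝓛(x) of pairs (m(x'), u(x')) reachable in one move from an
-- Exco-Nim position x with n = k + 1 ≥ 3 piles is described by m(x) and u(x)
-- alone: (a , b) ∈ 𝓛(x) iff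
--     a ≤ m ,   m + k·a ≤ b ,   b + m ≤ u + a ,   b < u
-- (the predicate 'Admissible' below), so positions of V(m,u) share 𝓛.
--
-- The "spike" tuple (0, a, …, a, v, a, …, a) is
-- the smallest tuple with minimum a that keeps v at a pile.
-- Soundness (every move lands in an admissible pair) holds for all n ≥ 1 by
-- comparing x' with a spike and with x. Completeness builds the move inside
-- the box between a spike and x lowered to a at one pile: one pile F stays
-- fixed, another pile D drops to a. With p a minimal pile and q a
-- second-minimal one, (F , D) = (p , q) or (q , p) works; the second choice
-- needs n ≥ 3. The corollary is then immediate.

open import Defs
open import Data.Nat
open import Data.Nat.Properties hiding (suc-injective; _≟_)
open import Data.Nat.Tactic.RingSolver using (solve-∀)
open import Data.Fin using (Fin; zero; suc; punchIn; punchOut)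
open import Data.Fin.Properties using (suc-injective; punchInᵢ≢i; punchIn-punchOut)
  renaming (_≟_ to _≟ᶠ_)
open import Data.Vec.Functional using (_∷_; tail; updateAt)
open import Data.Vec.Functional.Properties using (updateAt-updates; updateAt-minimal)
open import Data.Product using (_×_; _,_; proj₁; proj₂; ∃)
open import Function using (const; _∘_)
open import Relation.Binary.PropositionalEquality
open import Relation.Nullary using (Dec; yes; no)

private
  variable
    k : ℕ

assign : (Fin k → ℕ) → Fin k → ℕ → Fin k → ℕ
assign f i v = updateAt f i (const v)

_≤ᵖ_ : (f g : Fin k → ℕ) → Set
f ≤ᵖ g = ∀ j → f j ≤ g j

sum-assign : (f : Fin k → ℕ) (i : Fin k) (v : ℕ) → sumF (assign f i v) + f i ≡ sumF f + v
sum-assign f zero v = reorder v (sumF (tail f)) (f zero)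
  where
  reorder : ∀ a b c → a + b + c ≡ c + b + a
  reorder = solve-∀
sum-assign f (suc i) v = begin
  f zero + sumF (assign (tail f) i v) + f (suc i)   ≡⟨ +-assoc (f zero) _ _ ⟩
  f zero + (sumF (assign (tail f) i v) + f (suc i)) ≡⟨ cong (f zero +_) (sum-assign (tail f) i v) ⟩
  f zero + (sumF (tail f) + v)                      ≡⟨ +-assoc (f zero) _ _ ⟨
  f zero + sumF (tail f) + v                        ∎
  where open ≡-Reasoning

assign-≤ : (f g : Fin k → ℕ) (i : Fin k) (v : ℕ)
  → (∀ j → i ≢ j → f j ≤ g j) → v ≤ g i → assign f i v ≤ᵖ g
assign-≤ f g i v rest here j with i ≟ᶠ j
... | yes refl = ≤-trans (≤-reflexive (updateAt-updates i f)) here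
... | no i≢j   = ≤-trans (≤-reflexive (updateAt-minimal j i f (i≢j ∘ sym))) (rest j i≢j)

≤-assign : (f g : Fin k → ℕ) (i : Fin k) (v : ℕ)
  → (∀ j → i ≢ j → f j ≤ g j) → f i ≤ v → f ≤ᵖ assign g i v
≤-assign f g i v rest here j with i ≟ᶠ j
... | yes refl = ≤-trans here (≤-reflexive (sym (updateAt-updates i g)))
... | no i≢j   = ≤-trans (rest j i≢j) (≤-reflexive (sym (updateAt-minimal j i g (i≢j ∘ sym))))

sum-mono : (f g : Fin k → ℕ) → f ≤ᵖ g → sumF f ≤ sumF g
sum-mono {zero}  f g f≤g = z≤n
sum-mono {suc k} f g f≤g = +-mono-≤ (f≤g zero) (sum-mono (tail f) (tail g) (f≤g ∘ suc))

sum-gap-≥ : (f g : Fin k → ℕ) → f ≤ᵖ g → ∀ j → sumF f + g j ≤ sumF g + f j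
sum-gap-≥ f g f≤g j = begin
  sumF f + g j                  ≡⟨ sum-assign f j (g j) ⟨
  sumF (assign f j (g j)) + f j ≤⟨ +-monoˡ-≤ (f j) (sum-mono _ g below) ⟩
  sumF g + f j                  ∎
  where
  open ≤-Reasoning
  below : assign f j (g j) ≤ᵖ g
  below = assign-≤ f g j (g j) (λ i _ → f≤g i) ≤-refl

box-sum : (lo hi : Fin k → ℕ) → lo ≤ᵖ hi → ∀ t → sumF lo ≤ t → t ≤ sumF hi
  → ∃ λ z → lo ≤ᵖ z × z ≤ᵖ hi × sumF z ≡ t
box-sum {zero}  lo hi lo≤hi t lo≤t t≤hi = (λ ()) , (λ ()) , (λ ()) , sym (n≤0⇒n≡0 t≤hi)
box-sum {suc k} lo hi lo≤hi t lo≤t t≤hi with t ≤? hi zero + sumF (tail lo)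
... | yes t≤ = (t ∸ rest) ∷ tail lo , lower , upper , m∸n+n≡m rest≤t
  where
  -- the first entry absorbs everything beyond the minimal tail
  rest = sumF (tail lo)
  rest≤t : rest ≤ t
  rest≤t = ≤-trans (m≤n+m rest (lo zero)) lo≤t
  lower : lo ≤ᵖ ((t ∸ rest) ∷ tail lo)
  lower zero    = ≤-trans (≤-reflexive (sym (m+n∸n≡m (lo zero) rest))) (∸-monoˡ-≤ rest lo≤t)
  lower (suc i) = ≤-refl
  upper : ((t ∸ rest) ∷ tail lo) ≤ᵖ hi
  upper zero    = ≤-trans (∸-monoˡ-≤ rest t≤) (≤-reflexive (m+n∸n≡m (hi zero) rest))
  upper (suc i) = lo≤hi (suc i)
... | no t≰ with box-sum (tail lo) (tail hi) (lo≤hi ∘ suc) (t ∸ hi zero) tail-lo≤ tail-≤hi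
  where
  -- the first entry is saturated at hi zero and the tail takes the rest
  tail-lo≤ : sumF (tail lo) ≤ t ∸ hi zero
  tail-lo≤ = ≤-trans (≤-reflexive (sym (m+n∸m≡n (hi zero) _))) (∸-monoˡ-≤ (hi zero) (<⇒≤ (≰⇒> t≰)))
  tail-≤hi : t ∸ hi zero ≤ sumF (tail hi)
  tail-≤hi = ≤-trans (∸-monoˡ-≤ (hi zero) t≤hi) (≤-reflexive (m+n∸m≡n (hi zero) _))
... | z , lo≤z , z≤hi , Σz = hi zero ∷ z , lower , upper , total
  where
  lower : lo ≤ᵖ (hi zero ∷ z)
  lower zero    = lo≤hi zero
  lower (suc i) = lo≤z i
  upper : (hi zero ∷ z) ≤ᵖ hi
  upper zero    = ≤-refl
  upper (suc i) = z≤hi i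
  total : hi zero + sumF z ≡ t
  total = trans (cong (hi zero +_) Σz) (m+[n∸m]≡n (≤-trans (m≤m+n (hi zero) _) (<⇒≤ (≰⇒> t≰))))

minF-≤ : (f : Fin (suc k) → ℕ) (i : Fin (suc k)) → minF f ≤ f i
minF-≤ {zero}  f zero    = ≤-refl
minF-≤ {suc k} f zero    = m⊓n≤m _ _
minF-≤ {suc k} f (suc i) = ≤-trans (m⊓n≤n (f zero) _) (minF-≤ (tail f) i)

minF-glb : (f : Fin (suc k) → ℕ) (c : ℕ) → (∀ i → c ≤ f i) → c ≤ minF f
minF-glb {zero}  f c c≤f = c≤f zero
minF-glb {suc k} f c c≤f = ⊓-glb (c≤f zero) (minF-glb (tail f) c (c≤f ∘ suc))

argmin : (f : Fin (suc k) → ℕ) → ∃ λ i → minF f ≡ f i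
argmin {zero}  f = zero , refl
argmin {suc k} f with f zero ≤? minF (tail f)
... | yes ≤tail = zero , m≤n⇒m⊓n≡m ≤tail
... | no ≰tail with argmin (tail f)
...   | j , eq = suc j , trans (m≥n⇒m⊓n≡n (≰⇒≥ ≰tail)) eq

second-min : (f : Fin (suc (suc k)) → ℕ) (p : Fin (suc (suc k)))
  → ∃ λ q → q ≢ p × (∀ j → p ≢ j → f q ≤ f j)
second-min f p with argmin (f ∘ punchIn p)
... | j , eq = punchIn p j , punchInᵢ≢i p j , minimal
  where
  minimal : ∀ i → p ≢ i → f (punchIn p j) ≤ f i
  minimal i p≢i = begin
    f (punchIn p j)                       ≡⟨ eq ⟨
    minF (f ∘ punchIn p)                  ≤⟨ minF-≤ (f ∘ punchIn p) (punchOut p≢i) ⟩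
    f (punchIn p (punchOut p≢i))          ≡⟨ cong f (punchIn-punchOut p≢i) ⟩
    f i                                   ∎
    where open ≤-Reasoning

mOf-≤ : (x : Position (suc k)) (i : Fin (suc k)) → mOf x ≤ x (suc i)
mOf-≤ x = minF-≤ (x ∘ suc)

mOf-attained : (x : Position (suc k)) → ∃ λ i → mOf x ≡ x (suc i)
mOf-attained x = argmin (x ∘ suc)

spike : ℕ → Fin (suc k) → ℕ → Position (suc k)
spike a i v = assign (0 ∷ const a) (suc i) v

sum-spike : (a : ℕ) (i : Fin (suc k)) (v : ℕ) → sumF (spike a i v) ≡ k * a + v
sum-spike {k} a i v = +-cancelʳ-≡ a _ _ (begin
  sumF (spike a i v) + a         ≡⟨ sum-assign (0 ∷ const a) (suc i) v ⟩
  sumF {suc k} (const a) + v     ≡⟨ cong (_+ v) (sum-const (suc k)) ⟩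
  a + k * a + v                  ≡⟨ reorder a (k * a) v ⟩
  k * a + v + a                  ∎)
  where
  open ≡-Reasoning
  sum-const : ∀ l → sumF {l} (const a) ≡ l * a
  sum-const zero    = refl
  sum-const (suc l) = cong (a +_) (sum-const l)
  reorder : ∀ a b c → a + b + c ≡ b + c + a
  reorder = solve-∀

spike-≤ : (a : ℕ) (i : Fin (suc k)) (v : ℕ) (y : Position (suc k))
  → (∀ j → i ≢ j → a ≤ y (suc j)) → v ≤ y (suc i) → spike a i v ≤ᵖ y
spike-≤ a i v y a≤y v≤y = assign-≤ (0 ∷ const a) y (suc i) v base≤y v≤y
  where
  base≤y : ∀ j → suc i ≢ j → (0 ∷ const a) j ≤ y j
  base≤y zero    _     = z≤n
  base≤y (suc j) si≢sj = a≤y j (si≢sj ∘ cong suc)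

spike-≥ : (a : ℕ) (i : Fin (suc k)) (v : ℕ) → a ≤ v → ∀ j → a ≤ spike a i v (suc j)
spike-≥ a i v a≤v j with i ≟ᶠ j
... | yes refl = ≤-trans a≤v (≤-reflexive (sym (updateAt-updates (suc i) (0 ∷ const a))))
... | no i≢j   = ≤-reflexive (sym (updateAt-minimal (suc j) (suc i) (0 ∷ const a) (i≢j ∘ sym ∘ suc-injective)))

Admissible : ℕ → ℕ → ℕ → ℕ → ℕ → Set
Admissible k m u a b = a ≤ m × m + k * a ≤ b × b + m ≤ u + a × b < u

move-admissible : (x x' : Position (suc k)) → Move x x'
  → Admissible k (mOf x) (uOf x) (mOf x') (uOf x')
move-admissible {k} x x' (x'≤x , u'<u , i , fixed) = min-drops , lower , upper , u'<u
  where
  a = mOf x'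
  min-drops : a ≤ mOf x
  min-drops with mOf-attained x
  ... | p , eq = ≤-trans (mOf-≤ x' p) (≤-trans (x'≤x (suc p)) (≤-reflexive (sym eq)))
  -- x' lies above the spike that keeps the fixed pile i
  lower : mOf x + k * a ≤ uOf x'
  lower = begin
    mOf x + k * a                ≤⟨ +-monoˡ-≤ (k * a) (mOf-≤ x i) ⟩
    x (suc i) + k * a            ≡⟨ +-comm (x (suc i)) (k * a) ⟩
    k * a + x (suc i)            ≡⟨ sum-spike a i (x (suc i)) ⟨
    sumF (spike a i (x (suc i))) ≤⟨ sum-mono _ x' above-spike ⟩
    uOf x'                       ∎
    where
    open ≤-Reasoning
    above-spike : spike a i (x (suc i)) ≤ᵖ x'
    above-spike = spike-≤ a i (x (suc i)) x' (λ j _ → mOf-≤ x' j) (≤-reflexive (sym fixed))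
  -- the total drop is at least the drop at a pile where x' attains its minimum
  upper : uOf x' + mOf x ≤ uOf x + a
  upper with mOf-attained x'
  ... | r , eq = begin
    uOf x' + mOf x     ≤⟨ +-monoʳ-≤ (uOf x') (mOf-≤ x r) ⟩
    uOf x' + x (suc r) ≤⟨ sum-gap-≥ x' x x'≤x (suc r) ⟩
    uOf x + x' (suc r) ≡⟨ cong (uOf x +_) eq ⟨
    uOf x + a          ∎
    where open ≤-Reasoning

-- Reachability: keeping pile F and lowering pile D ≠ F to a, every b between
-- the sums of the spike (least such position) and of x lowered at D (largest
-- such position) is reached, with minimum exactly a.
reach : (x : Position (suc k)) (F D : Fin (suc k)) → F ≢ D → (a b : ℕ)
  → (∀ j → a ≤ x (suc j)) → x (suc F) + k * a ≤ b → b + x (suc D) ≤ uOf x + a → b < uOf x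
  → InL x a b
reach {k} x F D F≢D a b a≤x lb ub b<u = conclude (box-sum lo hi lo≤hi b Σlo≤b b≤Σhi)
  where
  lo hi : Position (suc k)
  lo = spike a F (x (suc F))
  hi = assign x (suc D) a
  loF : lo (suc F) ≡ x (suc F)
  loF = updateAt-updates (suc F) (0 ∷ const a)
  loD : lo (suc D) ≡ a
  loD = updateAt-minimal (suc D) (suc F) (0 ∷ const a) (F≢D ∘ sym ∘ suc-injective)
  hiF : hi (suc F) ≡ x (suc F)
  hiF = updateAt-minimal (suc F) (suc D) x (F≢D ∘ suc-injective)
  hiD : hi (suc D) ≡ a
  hiD = updateAt-updates (suc D) x
  lo≤hi : lo ≤ᵖ hi
  lo≤hi = ≤-assign lo x (suc D) a (λ j _ → spike-≤ a F _ x (λ i _ → a≤x i) ≤-refl j) (≤-reflexive loD)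
  hi≤x : hi ≤ᵖ x
  hi≤x = assign-≤ x x (suc D) a (λ _ _ → ≤-refl) (a≤x D)
  Σlo≤b : sumF lo ≤ b
  Σlo≤b = ≤-trans (≤-reflexive (trans (sum-spike a F _) (+-comm (k * a) _))) lb
  b≤Σhi : b ≤ sumF hi
  b≤Σhi = +-cancelʳ-≤ (x (suc D)) b (sumF hi) (≤-trans ub (≤-reflexive (sym (sum-assign x (suc D) a))))
  conclude : (∃ λ z → lo ≤ᵖ z × z ≤ᵖ hi × sumF z ≡ b) → InL x a b
  conclude (z , lo≤z , z≤hi , Σz) = z , (z≤x , subst (_< uOf x) (sym Σz) b<u , F , zF) , mz , Σz
    where
    z≤x : z ≤ᵖ x
    z≤x j = ≤-trans (z≤hi j) (hi≤x j)
    zF : z (suc F) ≡ x (suc F)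
    zF = ≤-antisym (≤-trans (z≤hi (suc F)) (≤-reflexive hiF)) (≤-trans (≤-reflexive (sym loF)) (lo≤z (suc F)))
    mz : mOf z ≡ a
    mz = ≤-antisym (≤-trans (mOf-≤ z D) (≤-trans (z≤hi (suc D)) (≤-reflexive hiD)))
                   (minF-glb (z ∘ suc) a (λ j → ≤-trans (spike-≥ a F _ (a≤x F) j) (lo≤z (suc j))))

-- Arithmetic for the second case of completeness; it is where n ≥ 3 (k ≥ 2) enters.
lower-bound-transfer : ∀ k' {a m s u b} → a ≤ m → a ≤ s → suc (suc k') * s + m ≤ u
  → u + a < b + s → s + suc (suc k') * a ≤ b
lower-bound-transfer k' {a} {m} {s} {u} {b} a≤m a≤s total u+a<b+s =
  <⇒≤ (+-cancelʳ-< s _ _ (begin-strict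
    s + K * a + s              ≡⟨ expand₁ s a k' ⟩
    (k' * a + a) + (a + s + s) ≤⟨ +-monoˡ-≤ (a + s + s) (+-mono-≤ (*-monoʳ-≤ k' a≤s) a≤m) ⟩
    (k' * s + m) + (a + s + s) ≡⟨ expand₂ s m a k' ⟩
    K * s + m + a              ≤⟨ +-monoˡ-≤ a total ⟩
    u + a                      <⟨ u+a<b+s ⟩
    b + s                      ∎))
  where
  open ≤-Reasoning
  K = suc (suc k')
  expand₁ : ∀ s a k' → s + suc (suc k') * a + s ≡ (k' * a + a) + (a + s + s)
  expand₁ = solve-∀
  expand₂ : ∀ s m a k' → (k' * s + m) + (a + s + s) ≡ suc (suc k') * s + m + a
  expand₂ = solve-∀

-- Completeness for n ≥ 3: with p a minimal and q a second-minimal pile,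
-- fix p and lower q if b + x_q ≤ u + a, otherwise fix q and lower p.
admissible-reachable : ∀ k' (x : Position (suc (suc (suc k')))) a b
  → Admissible (suc (suc k')) (mOf x) (uOf x) a b → InL x a b
admissible-reachable k' x a b (a≤m , lb , ub , b<u) = choose (b + s ≤? uOf x + a)
  where
  K = suc (suc k')
  p = proj₁ (mOf-attained x)
  m≡xp : mOf x ≡ x (suc p)
  m≡xp = proj₂ (mOf-attained x)
  q = proj₁ (second-min (x ∘ suc) p)
  q≢p : q ≢ p
  q≢p = proj₁ (proj₂ (second-min (x ∘ suc) p))
  s = x (suc q)
  a≤x : ∀ j → a ≤ x (suc j)
  a≤x j = ≤-trans a≤m (mOf-≤ x j)
  -- all piles but p are ≥ s, so x lies above the spike with s and m at p
  total : K * s + mOf x ≤ uOf x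
  total = ≤-trans (≤-reflexive (sym (sum-spike s p (mOf x))))
                  (sum-mono _ x (spike-≤ s p _ x (proj₂ (proj₂ (second-min (x ∘ suc) p))) (≤-reflexive m≡xp)))
  choose : Dec (b + s ≤ uOf x + a) → InL x a b
  choose (yes ub′) = reach x p q (q≢p ∘ sym) a b a≤x (subst (λ v → v + K * a ≤ b) m≡xp lb) ub′ b<u
  choose (no ub′)  = reach x q p q≢p a b a≤x
    (lower-bound-transfer k' a≤m (≤-trans a≤m (mOf-≤ x q)) total (≰⇒> ub′))
    (subst (λ v → b + v ≤ uOf x + a) m≡xp ub) b<u

L-on-V : ∀ k' {m u} (x : Position (suc (suc (suc k')))) → InV x m u → ∀ a b
  → (InL x a b → Admissible (suc (suc k')) m u a b) × (Admissible (suc (suc k')) m u a b → InL x a b)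
L-on-V k' x (refl , refl) a b = sound , admissible-reachable k' x a b
  where
  sound : InL x a b → Admissible (suc (suc k')) (mOf x) (uOf x) a b
  sound (x' , move , refl , refl) = move-admissible x x' move

corollary3p3 : (n : ℕ) → 3 ≤ n → (m u : ℕ)
    → (x y : Position n) → InV x m u → InV y m u
    → (a b : ℕ) → (InL x a b → InL y a b) × (InL y a b → InL x a b)
corollary3p3 (suc (suc (suc k'))) (s≤s (s≤s (s≤s _))) m u x y x∈V y∈V a b =
  (λ x↦ab → proj₂ (L-on-V k' y y∈V a b) (proj₁ (L-on-V k' x x∈V a b) x↦ab)) ,
  (λ y↦ab → proj₂ (L-on-V k' x x∈V a b) (proj₁ (L-on-V k' y y∈V a b) y↦ab))
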